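{- For all integers $k>1$ and $\alpha\ge1$, $$N_\alpha(k,k)\le (k^3-k^2+k)\binom{k}{2}.$$
   Context: A factor of a word is a contiguous subword. A $k$-power is a word $u^k$ ($k$ copies of $u$) for a nonempty word $u$. A $k$-anti-power is a word $w=w_1\cdots w_k$ with $|w_1|=\cdots=|w_k|$ and $w_1,\dots,w_k$ pairwise distinct. $N_\alpha(k,k)$ is the smallest positive integer such that every word of length $N_\alpha(k,k)$ over an alphabet of size $\alpha$ has a factor that is a $k$-power or a factor that is a $k$-anti-power. -}

module Defs where

open import Data.Nat using (ℕ; suc; _≤_; _+_; _*_; _∸_; _^_)
open import Data.Nat.Combinatorics using (_C_)
open import Data.Fin using (Fin)
open import Data.List using (List; []; _∷_; _++_; length; concat; replicate)
open import Data.List.Relation.Unary.All using (All)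
open import Data.List.Relation.Unary.Unique.Propositional using (Unique)
open import Data.Product using (Σ; ∃; ∃-syntax; _×_)
open import Data.Sum using (_⊎_)
open import Relation.Binary.PropositionalEquality using (_≡_; _≢_)

IsFactor : {A : Set} → List A → List A → Set
IsFactor {A} f w = Σ (List A) λ x → Σ (List A) λ y → x ++ f ++ y ≡ w

IsPower : {A : Set} → ℕ → List A → Set
IsPower {A} k f = Σ (List A) λ u → u ≢ [] × f ≡ concat (replicate k u)

IsAntiPower : {A : Set} → ℕ → List A → Set
IsAntiPower {A} k f = Σ (List (List A)) λ ws → Σ ℕ λ m →
  length ws ≡ k × All (λ v → length v ≡ m) ws × Unique ws × f ≡ concat ws

Unavoidable : ℕ → ℕ → ℕ → Set
Unavoidable α k n = (w : List (Fin α)) → length w ≡ n →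
  Σ (List (Fin α)) λ f → IsFactor f w × (IsPower k f ⊎ IsAntiPower k f)

IsNαkk : ℕ → ℕ → ℕ → Set
IsNαkk α k n = 1 ≤ n × Unavoidable α k n × ((m : ℕ) → 1 ≤ m → Unavoidable α k m → n ≤ m)

bound : ℕ → ℕ
bound k = (k ^ 3 ∸ k ^ 2 + k) * (k C 2)

-- Put k = a + 1, c = binom(k,2), M = k a c, and look at the first k blocks of length m
-- of a word w, for each of the c + 1 block lengths m = M, …, M + c.  If for some m the
-- blocks are pairwise distinct, they form a k-anti-power.  Otherwise every m has a
-- collision, a pair i < j < k with equal blocks i and j; as there are only c such pairs,
-- two lengths m < m + δ collide at the same pair (i , i + d).  Comparing the two
-- collisions shows that w has period dδ on a stretch of length (a + 1)dδ starting at
-- (i + d)m + iδ, which is therefore a k-power.  Hence every word of length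
-- k(M + c) = (k³ − k² + k)c contains one or the other, and N_α(k,k) is found below it
-- by search, both properties being decidable.
module Submission where

open import Defs
open import Data.Nat using (ℕ; _≤_; _<_)
open import Data.Product using (Σ; _×_)

open import Data.Fin as Fin using (Fin; toℕ)
open import Data.Fin.Properties using (toℕ<n; pigeonhole; all?)
open import Data.List
  using (List; []; _∷_; _++_; length; concat; replicate; take; drop; applyUpTo; upTo)
open import Data.List.Properties
  using ( ≡-dec; ∷-injective; ++-identityʳ; length-take; length-drop; length-++
        ; length-applyUpTo; take-drop; take-take; drop-drop; take-[]; take++drop≡id
        ; map-cong; map-upTo)
open import Data.List.Membership.Propositional using (_∈_)
open import Data.List.Membership.Propositional.Properties using (∈-++⁺ˡ; ∈-++⁺ʳ; ∈-applyUpTo⁺)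
open import Data.List.Membership.Setoid.Properties using (index-injective)
open import Data.List.Relation.Unary.Any using (index)
import Data.List.Relation.Unary.All as All
import Data.List.Relation.Unary.All.Properties as All
open import Data.List.Relation.Unary.AllPairs using ([])
import Data.List.Relation.Unary.AllPairs.Properties as AllPairs
open import Data.List.Relation.Unary.Unique.Propositional using (Unique)
open import Data.List.Relation.Unary.Unique.DecPropositional using (unique?)
import Data.Nat as ℕ
open import Data.Nat using (zero; suc; _+_; _*_; _∸_; _^_; _⊓_; s≤s; z≤n; s≤s⁻¹)
open import Data.Nat.Combinatorics using (_C_; nC1≡n; nCk+nC[k+1]≡[n+1]C[k+1])
open import Data.Nat.Induction using (<-wellFounded)
open import Data.Nat.Properties
open import Data.Nat.Tactic.RingSolver using (solve-∀)
import Data.Product as Product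
open import Data.Product using (∃₂; ∃-syntax; _,_)
open import Data.Sum using (_⊎_; inj₁; inj₂)
open import Function using (_∘_)
open import Induction.WellFounded using (Acc; acc)
open import Relation.Binary using (DecidableEquality)
open import Relation.Binary.PropositionalEquality
  using (_≡_; _≢_; refl; sym; trans; cong; cong₂; setoid; module ≡-Reasoning)
open import Relation.Nullary using (Dec; yes; no; ¬_; ¬?; _×-dec_; _⊎-dec_)
open import Relation.Nullary.Decidable using (map′; decidable-stable)
open import Relation.Unary using (Decidable)

take-+ : ∀ {A : Set} m n (xs : List A) → take (m + n) xs ≡ take m xs ++ take n (drop m xs)
take-+ zero    n xs       = refl
take-+ (suc m) n []       = sym (take-[] n)
take-+ (suc m) n (x ∷ xs) = cong (x ∷_) (take-+ m n xs)

applyUpTo-cong : ∀ {A : Set} {f g : ℕ → A} → (∀ i → f i ≡ g i) → ∀ n → applyUpTo f n ≡ applyUpTo g n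
applyUpTo-cong {f = f} {g} f≗g n =
  trans (sym (map-upTo f n)) (trans (map-cong f≗g (upTo n)) (map-upTo g n))

m<n⇒∃[o]0<o×m+o≡n : ∀ {m n} → m < n → ∃[ o ] 0 < o × m + o ≡ n
m<n⇒∃[o]0<o×m+o≡n m<n = _ , m<n⇒0<n∸m m<n , m+[n∸m]≡n (<⇒≤ m<n)

orderedPairs : ℕ → List (ℕ × ℕ)
orderedPairs zero    = []
orderedPairs (suc k) = orderedPairs k ++ applyUpTo (_, k) k

∈-orderedPairs : ∀ {i j k} → i < j → j < k → (i , j) ∈ orderedPairs k
∈-orderedPairs {k = suc k} i<j j<1+k with m<1+n⇒m<n∨m≡n j<1+k
... | inj₁ j<k  = ∈-++⁺ˡ (∈-orderedPairs i<j j<k)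
... | inj₂ refl = ∈-++⁺ʳ (orderedPairs k) (∈-applyUpTo⁺ (_, k) i<j)

length-orderedPairs : ∀ k → length (orderedPairs k) ≡ k C 2
length-orderedPairs zero    = refl
length-orderedPairs (suc k) = begin
  length (orderedPairs k ++ applyUpTo (_, k) k)            ≡⟨ length-++ (orderedPairs k) ⟩
  length (orderedPairs k) + length (applyUpTo (_, k) k)    ≡⟨ cong₂ _+_ (length-orderedPairs k) (length-applyUpTo (_, k) k) ⟩
  k C 2 + k                                                ≡⟨ +-comm (k C 2) k ⟩
  k + k C 2                                                ≡⟨ cong (_+ k C 2) (nC1≡n k) ⟨
  k C 1 + k C 2                                            ≡⟨ nCk+nC[k+1]≡[n+1]C[k+1] k 1 ⟩
  suc k C 2                                                ∎
  where open ≡-Reasoning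

module _ {A : Set} where

  slice : ℕ → ℕ → List A → List A
  slice s n w = take n (drop s w)

  slice-isFactor : ∀ s n w → IsFactor (slice s n w) w
  slice-isFactor s n w =
    take s w , drop n (drop s w) ,
    trans (cong (take s w ++_) (take++drop≡id n (drop s w))) (take++drop≡id s w)

  length-slice : ∀ s n w → s + n ≤ length w → length (slice s n w) ≡ n
  length-slice s n w s+n≤ = begin
    length (take n (drop s w)) ≡⟨ length-take n (drop s w) ⟩
    n ⊓ length (drop s w)      ≡⟨ cong (n ⊓_) (length-drop s w) ⟩
    n ⊓ (length w ∸ s)         ≡⟨ m≤n⇒m⊓n≡m (m+n≤o⇒m≤o∸n n (≤-trans (≤-reflexive (+-comm n s)) s+n≤)) ⟩
    n                          ∎
    where open ≡-Reasoning

  slice-+ : ∀ s m n w → slice s (m + n) w ≡ slice s m w ++ slice (s + m) n w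
  slice-+ s m n w = trans (take-+ m n (drop s w)) (cong (λ v → slice s m w ++ take n v) (drop-drop s m w))

  slice-prefix : ∀ s {m n} w → n ≤ m → take n (slice s m w) ≡ slice s n w
  slice-prefix s {m} {n} w n≤m = trans (take-take n m (drop s w)) (cong (λ l → take l (drop s w)) (m≤n⇒m⊓n≡m n≤m))

  slice-slice : ∀ r s {m n} w → r + n ≤ m → slice r n (slice s m w) ≡ slice (s + r) n w
  slice-slice r s {m} {n} w r+n≤m = begin
    take n (drop r (take m v))         ≡⟨ take-drop n r (take m v) ⟩
    drop r (take (r + n) (take m v))   ≡⟨ cong (drop r) (take-take (r + n) m v) ⟩
    drop r (take ((r + n) ⊓ m) v)      ≡⟨ cong (λ l → drop r (take l v)) (m≤n⇒m⊓n≡m r+n≤m) ⟩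
    drop r (take (r + n) v)            ≡⟨ take-drop n r v ⟨
    take n (drop r v)                  ≡⟨ cong (take n) (drop-drop s r w) ⟩
    take n (drop (s + r) w)            ∎
    where
    open ≡-Reasoning
    v = drop s w

  slice-≡-prefix : ∀ s t {m n} w → slice s m w ≡ slice t m w → n ≤ m → slice s n w ≡ slice t n w
  slice-≡-prefix s t w eq n≤m =
    trans (sym (slice-prefix s w n≤m)) (trans (cong (take _) eq) (slice-prefix t w n≤m))

  slice-≡-infix : ∀ s t r n {m} w → slice s m w ≡ slice t m w → r + n ≤ m →
                  slice (s + r) n w ≡ slice (t + r) n w
  slice-≡-infix s t r n w eq r+n≤m =
    trans (sym (slice-slice r s w r+n≤m)) (trans (cong (slice r _) eq) (slice-slice r t w r+n≤m))

  periodic⇒power : ∀ n s p w → slice s (n * p) w ≡ slice (s + p) (n * p) w →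
                   slice s (suc n * p) w ≡ concat (replicate (suc n) (slice s p w))
  periodic⇒power zero s p w _ =
    trans (cong (λ l → slice s l w) (+-identityʳ p)) (sym (++-identityʳ (slice s p w)))
  periodic⇒power (suc n) s p w periodic = begin
    slice s (p + suc n * p) w
      ≡⟨ slice-+ s p (suc n * p) w ⟩
    slice s p w ++ slice (s + p) (suc n * p) w
      ≡⟨ cong (slice s p w ++_) (periodic⇒power n (s + p) p w (slice-≡-infix s (s + p) p (n * p) w periodic ≤-refl)) ⟩
    slice s p w ++ concat (replicate (suc n) (slice (s + p) p w))
      ≡⟨ cong (λ u → slice s p w ++ concat (replicate (suc n) u))
              (slice-≡-prefix s (s + p) w periodic (m≤m+n p (n * p))) ⟨
    slice s p w ++ concat (replicate (suc n) (slice s p w))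
      ∎
    where open ≡-Reasoning

  block : ℕ → List A → ℕ → List A
  block m w i = slice (i * m) m w

  length-block : ∀ m w i → suc i * m ≤ length w → length (block m w i) ≡ m
  length-block m w i i+1≤ = length-slice (i * m) m w (≤-trans (≤-reflexive (+-comm (i * m) m)) i+1≤)

  concat-blocks : ∀ k m w → concat (applyUpTo (block m w) k) ≡ take (k * m) w
  concat-blocks zero    m w = refl
  concat-blocks (suc k) m w = begin
    take m w ++ concat (applyUpTo (block m w ∘ suc) k)
      ≡⟨ cong (λ bs → take m w ++ concat bs) (applyUpTo-cong block-suc k) ⟩
    take m w ++ concat (applyUpTo (block m (drop m w)) k)
      ≡⟨ cong (take m w ++_) (concat-blocks k m (drop m w)) ⟩
    take m w ++ take (k * m) (drop m w)
      ≡⟨ take-+ m (k * m) w ⟨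
    take (m + k * m) w
      ∎
    where
    open ≡-Reasoning
    block-suc : ∀ i → block m w (suc i) ≡ block m (drop m w) i
    block-suc i = cong (take m) (sym (drop-drop m (i * m) w))

  antiPower-of-distinct-blocks : ∀ {k m w} → k * m ≤ length w →
    (∀ {i j} → i < j → j < k → block m w i ≢ block m w j) →
    ∃[ f ] IsFactor f w × IsAntiPower k f
  antiPower-of-distinct-blocks {k} {m} {w} km≤ distinct =
    take (k * m) w , slice-isFactor 0 (k * m) w ,
    applyUpTo (block m w) k , m , length-applyUpTo (block m w) k ,
    All.applyUpTo⁺₁ (block m w) k (λ {i} i<k → length-block m w i (≤-trans (*-monoˡ-≤ m i<k) km≤)) ,
    AllPairs.applyUpTo⁺₁ (block m w) k distinct ,
    sym (concat-blocks k m w)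

  -- Position (i + d)m + iδ + r and the one dδ further on are both matched, through
  -- block i, with position i(m + δ) + r.
  power-of-repeated-collision : ∀ a i {d m δ} w → 0 < d → 0 < δ →
    block m w i ≡ block m w (i + d) → block (m + δ) w i ≡ block (m + δ) w (i + d) →
    i * δ + a * (d * δ) ≤ m → (i + d) * (m + δ) ≤ length w →
    ∃[ f ] IsFactor f w × IsPower (suc a) f
  power-of-repeated-collision a i {d} {m} {δ} w 0<d 0<δ short long fits inside =
    slice s (suc a * p) w , slice-isFactor s (suc a * p) w ,
    slice s p w , nonempty , periodic⇒power a s p w periodic
    where
    p = d * δ
    s = (i + d) * m + i * δ
    end≡ : (i + d) * (m + δ) ≡ s + p
    end≡ = distrib i d m δ
      where
      distrib : ∀ i d m δ → (i + d) * (m + δ) ≡ (i + d) * m + i * δ + d * δ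
      distrib = solve-∀
    periodic : slice s (a * p) w ≡ slice (s + p) (a * p) w
    periodic = begin
      slice s (a * p) w
        ≡⟨ slice-≡-infix (i * m) ((i + d) * m) (i * δ) (a * p) w short fits ⟨
      slice (i * m + i * δ) (a * p) w
        ≡⟨ cong (λ t → slice t (a * p) w) (*-distribˡ-+ i m δ) ⟨
      slice (i * (m + δ)) (a * p) w
        ≡⟨ slice-≡-prefix (i * (m + δ)) ((i + d) * (m + δ)) w long ap≤m+δ ⟩
      slice ((i + d) * (m + δ)) (a * p) w
        ≡⟨ cong (λ t → slice t (a * p) w) end≡ ⟩
      slice (s + p) (a * p) w
        ∎
      where
      open ≡-Reasoning
      ap≤m+δ : a * p ≤ m + δ
      ap≤m+δ = ≤-trans (m+n≤o⇒n≤o (i * δ) fits) (m≤m+n m δ)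
    nonempty : slice s p w ≢ []
    nonempty u≡[] = <⇒≢ (*-mono-≤ 0<d 0<δ)
      (trans (cong length (sym u≡[])) (length-slice s p w (≤-trans (≤-reflexive (sym end≡)) inside)))

  Collision : ℕ → ℕ → List A → Set
  Collision k m w = ∃[ j ] j < k × ∃[ i ] i < j × block m w i ≡ block m w j

  collision? : DecidableEquality A → ∀ k m w → Dec (Collision k m w)
  collision? _≟_ k m w = anyUpTo? (λ j → anyUpTo? (λ i → ≡-dec _≟_ (block m w i) (block m w j)) j) k

  collisionPair : ∀ {k m w} → Collision k m w → ℕ × ℕ
  collisionPair (j , _ , i , _ , _) = i , j

  collisionPair∈orderedPairs : ∀ {k m w} (col : Collision k m w) → collisionPair col ∈ orderedPairs k
  collisionPair∈orderedPairs (j , j<k , i , i<j , _) = ∈-orderedPairs i<j j<k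

module _ {A : Set} (_≟_ : DecidableEquality A) (a : ℕ) (w : List A)
         (long : suc a * (suc a * a * (suc a C 2) + suc a C 2) ≤ length w) where

  private
    k = suc a
    c = k C 2
    -- large enough that iδ + a·dδ ≤ (a + a²)c = M ≤ m, so the periodic stretch fits
    M = k * a * c

  same-pair⇒power : ∀ {m m'} → M ≤ m → m < m' → m' ≤ M + c →
    (X : Collision k m w) (Y : Collision k m' w) → collisionPair X ≡ collisionPair Y →
    ∃[ f ] IsFactor f w × IsPower k f
  same-pair⇒power {m} M≤m m<m' m'≤M+c (j , j<k , i , i<j , X) (.j , _ , .i , _ , Y) refl
    with m<n⇒∃[o]0<o×m+o≡n i<j | m<n⇒∃[o]0<o×m+o≡n m<m'
  ... | d , 0<d , refl | δ , 0<δ , refl =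
    power-of-repeated-collision a i w 0<d 0<δ X Y fits (≤-trans (*-mono-≤ (<⇒≤ j<k) m'≤M+c) long)
    where
    i+d≤a : i + d ≤ a
    i+d≤a = s≤s⁻¹ j<k
    δ≤c : δ ≤ c
    δ≤c = +-cancelˡ-≤ M δ c (≤-trans (+-monoˡ-≤ δ M≤m) m'≤M+c)
    distrib : ∀ i a d δ → i * δ + a * (d * δ) ≡ (i + a * d) * δ
    distrib = solve-∀
    fits : i * δ + a * (d * δ) ≤ m
    fits = begin
      i * δ + a * (d * δ) ≡⟨ distrib i a d δ ⟩
      (i + a * d) * δ     ≤⟨ *-mono-≤ (+-mono-≤ (m+n≤o⇒m≤o i i+d≤a) (*-monoʳ-≤ a (m+n≤o⇒n≤o i i+d≤a))) δ≤c ⟩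
      M                   ≤⟨ M≤m ⟩
      m                   ∎
      where open ≤-Reasoning

  collisions⇒power : (∀ {x} → x ≤ c → Collision k (M + x) w) → ∃[ f ] IsFactor f w × IsPower k f
  collisions⇒power collides =
    let x , y , x<y , same-index = pigeonhole (s≤s (≤-reflexive (length-orderedPairs k))) (index ∘ pair∈)
    in same-pair⇒power (m≤m+n M (toℕ x)) (+-monoʳ-< M x<y) (+-monoʳ-≤ M (s≤s⁻¹ (toℕ<n y)))
         (col x) (col y) (index-injective (setoid _) (pair∈ x) (pair∈ y) same-index)
    where
    col : (x : Fin (suc c)) → Collision k (M + toℕ x) w
    col x = collides (s≤s⁻¹ (toℕ<n x))
    pair∈ : (x : Fin (suc c)) → collisionPair (col x) ∈ orderedPairs k
    pair∈ x = collisionPair∈orderedPairs (col x)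

  power-or-antiPower : ∃[ f ] IsFactor f w × (IsPower k f ⊎ IsAntiPower k f)
  power-or-antiPower with anyUpTo? (λ x → ¬? (collision? _≟_ k (M + x) w)) (suc c)
  ... | yes (x , x<1+c , no-collision) =
    Product.map₂ (Product.map₂ inj₂) (antiPower-of-distinct-blocks
      (≤-trans (*-monoʳ-≤ k (+-monoʳ-≤ M (s≤s⁻¹ x<1+c))) long)
      (λ i<j j<k eq → no-collision (_ , j<k , _ , i<j , eq)))
  ... | no ¬some-free =
    Product.map₂ (Product.map₂ inj₁) (collisions⇒power λ x≤c →
      decidable-stable (collision? _≟_ k _ w) (λ ¬col → ¬some-free (_ , s≤s x≤c , ¬col)))

module _ {A : Set} (_≟_ : DecidableEquality A) where

  splits? : (P : List A → List A → Set) → (∀ x y → Dec (P x y)) →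
            ∀ w → Dec (∃₂ λ x y → x ++ y ≡ w × P x y)
  splits? P P? [] =
    map′ (λ p → [] , [] , refl , p) (λ { ([] , [] , refl , p) → p }) (P? [] [])
  splits? P P? (c ∷ w) =
    map′ to from (P? [] (c ∷ w) ⊎-dec splits? (λ x → P (c ∷ x)) (λ x → P? (c ∷ x)) w)
    where
    to : P [] (c ∷ w) ⊎ (∃₂ λ x y → x ++ y ≡ w × P (c ∷ x) y) → ∃₂ λ x y → x ++ y ≡ c ∷ w × P x y
    to (inj₁ p)                  = [] , c ∷ w , refl , p
    to (inj₂ (x , y , xy≡w , p)) = c ∷ x , y , cong (c ∷_) xy≡w , p
    from : (∃₂ λ x y → x ++ y ≡ c ∷ w × P x y) → P [] (c ∷ w) ⊎ (∃₂ λ x y → x ++ y ≡ w × P (c ∷ x) y)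
    from ([] , y , refl , p) = inj₁ p
    from (c′ ∷ x , y , eq , p) with ∷-injective eq
    ... | refl , xy≡w = inj₂ (x , y , xy≡w , p)

  factor? : (Q : List A → Set) → Decidable Q → ∀ w → Dec (∃[ f ] IsFactor f w × Q f)
  factor? Q Q? w =
    map′ (λ (x , z , xz≡w , f , y , fy≡z , q) → f , (x , y , trans (cong (x ++_) fy≡z) xz≡w) , q)
         (λ (f , (x , y , xfy≡w) , q) → x , f ++ y , xfy≡w , f , y , refl , q)
         (splits? (λ _ z → ∃₂ λ f y → f ++ y ≡ z × Q f)
                  (λ _ z → splits? (λ f _ → Q f) (λ f _ → Q? f) z) w)

  power? : ∀ k f → Dec (IsPower (suc k) f)
  power? k f =
    map′ (λ (u , _ , _ , u≢[] , f≡uᵏ) → u , u≢[] , f≡uᵏ)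
         (λ (u , u≢[] , f≡uᵏ) → u , concat (replicate k u) , sym f≡uᵏ , u≢[] , f≡uᵏ)
         (splits? (λ u _ → u ≢ [] × f ≡ concat (replicate (suc k) u))
                  (λ u _ → ¬? (≡-dec _≟_ u []) ×-dec ≡-dec _≟_ f _) f)

  EquallyLongDistinct : List (List A) → Set
  EquallyLongDistinct ws = ∃[ m ] All.All (λ v → length v ≡ m) ws × Unique ws

  equallyLongDistinct? : Decidable EquallyLongDistinct
  equallyLongDistinct? []       = yes (0 , All.[] , [])
  equallyLongDistinct? (v ∷ ws) =
    map′ (λ (same , distinct) → length v , same , distinct)
         (λ { (m , same@(v≡m All.∷ _) , distinct) →
                All.map (λ u≡m → trans u≡m (sym v≡m)) same , distinct })
         (All.all? (λ u → length u ℕ.≟ length v) (v ∷ ws) ×-dec unique? (≡-dec _≟_) (v ∷ ws))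

  partitions? : (R : List (List A) → Set) → Decidable R →
                ∀ k w → Dec (∃[ ws ] length ws ≡ k × concat ws ≡ w × R ws)
  partitions? R R? zero w =
    map′ (λ ([]≡w , r) → [] , refl , []≡w , r)
         (λ { ([] , _ , []≡w , r) → []≡w , r })
         (≡-dec _≟_ [] w ×-dec R? [])
  partitions? R R? (suc k) w =
    map′ (λ (v , z , vz≡w , ws , len , ws≡z , r) → v ∷ ws , cong suc len , trans (cong (v ++_) ws≡z) vz≡w , r)
         (λ { (v ∷ ws , len , vws≡w , r) → v , concat ws , vws≡w , ws , suc-injective len , refl , r })
         (splits? (λ v z → ∃[ ws ] length ws ≡ k × concat ws ≡ z × R (v ∷ ws))
                  (λ v z → partitions? (R ∘ (v ∷_)) (R? ∘ (v ∷_)) k z) w)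

  antiPower? : ∀ k f → Dec (IsAntiPower k f)
  antiPower? k f =
    map′ (λ (ws , len , ws≡f , m , same , distinct) → ws , m , len , same , distinct , sym ws≡f)
         (λ (ws , m , len , same , distinct , f≡ws) → ws , len , sym f≡ws , m , same , distinct)
         (partitions? EquallyLongDistinct equallyLongDistinct? k f)

allWords? : ∀ {α} n (Q : List (Fin α) → Set) → Decidable Q → Dec (∀ w → length w ≡ n → Q w)
allWords? zero Q Q? =
  map′ (λ { q [] refl → q }) (λ all → all [] refl) (Q? [])
allWords? (suc n) Q Q? =
  map′ (λ { all (c ∷ w) len → all c w (suc-injective len) })
       (λ all c w len → all (c ∷ w) (cong suc len))
       (all? λ c → allWords? n (Q ∘ (c ∷_)) (Q? ∘ (c ∷_)))

unavoidable? : ∀ α k n → Dec (Unavoidable α (suc k) n)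
unavoidable? α k n = allWords? n _ λ w →
  factor? Fin._≟_ _ (λ f → power? Fin._≟_ k f ⊎-dec antiPower? Fin._≟_ (suc k) f) w

module _ {P : ℕ → Set} (P? : Decidable P) where

  least-below : ∀ {n} → Acc _<_ n → P n → ∃[ m ] m ≤ n × P m × (∀ {l} → l < m → ¬ P l)
  least-below {n} (acc smaller) pn with anyUpTo? P? n
  ... | no none = n , ≤-refl , pn , λ l<n pl → none (_ , l<n , pl)
  ... | yes (l , l<n , pl) =
    let m , m≤l , pm , minimal = least-below (smaller l<n) pl
    in m , ≤-trans m≤l (<⇒≤ l<n) , pm , minimal

  least : ∀ {n} → P n → ∃[ m ] m ≤ n × P m × (∀ {l} → l < m → ¬ P l)
  least = least-below (<-wellFounded _)

bound-suc : ∀ a → bound (suc a) ≡ suc a * (suc a * a * (suc a C 2) + suc a C 2)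
bound-suc a = begin
  -- k ^ 3 reduces to k ^ 2 + a * k ^ 2 because k = suc a
  (k ^ 3 ∸ k ^ 2 + k) * c ≡⟨ cong (λ t → (t + k) * c) (m+n∸m≡n (k ^ 2) (a * k ^ 2)) ⟩
  (a * k ^ 2 + k) * c     ≡⟨ distrib a c ⟩
  k * (k * a * c + c)     ∎
  where
  open ≡-Reasoning
  k = suc a
  c = k C 2
  -- k ^ 2 written out, as the solver treats a power of a compound base as a constant
  distrib : ∀ a c → (a * ((1 + a) * ((1 + a) * 1)) + (1 + a)) * c ≡ (1 + a) * ((1 + a) * a * c + c)
  distrib = solve-∀

bound-unavoidable : ∀ α a → Unavoidable α (suc a) (bound (suc a))
bound-unavoidable α a w len = power-or-antiPower Fin._≟_ a w (≤-reflexive (trans (sym (bound-suc a)) (sym len)))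

bound-positive : ∀ a → 0 < a → 0 < bound (suc a)
bound-positive (suc b) _ = begin-strict
  0                        <⟨ s≤s z≤n ⟩
  suc b                    ≡⟨ nC1≡n (suc b) ⟨
  suc b C 1                ≤⟨ m≤m+n _ _ ⟩
  suc b C 1 + suc b C 2    ≡⟨ nCk+nC[k+1]≡[n+1]C[k+1] (suc b) 1 ⟩
  c                        ≤⟨ m≤n+m c M ⟩
  M + c                    ≤⟨ m≤n*m (M + c) k ⟩
  k * (M + c)              ≡⟨ bound-suc (suc b) ⟨
  bound k                  ∎
  where
  open ≤-Reasoning
  k = suc (suc b)
  c = k C 2
  M = k * suc b * c

corollary3p10 : (k α : ℕ) → 1 < k → 1 ≤ α →
    Σ ℕ λ n → IsNαkk α k n × n ≤ bound k
corollary3p10 (suc a) α (s≤s 0<a) _ =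
  let n , n≤bound , (1≤n , unavoidable) , minimal =
        least (λ n → 1 ≤? n ×-dec unavoidable? α a n) (bound-positive a 0<a , bound-unavoidable α a)
  in n , (1≤n , unavoidable , λ m 1≤m unavoidable-m → ≮⇒≥ λ m<n → minimal m<n (1≤m , unavoidable-m)) , n≤bound
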